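{- For all $n\in\mathbb{Z}$, $\gcd(\bar a_n,\bar b_n,\bar c_n)=1$, where $\bar a_n=-S_{n+2}T_{n+1}T_{n+2}^3T_{n+3}$, $\bar b_n=S_{n+1}S_{n+2}^3S_{n+3}T_{n+2}$, $\bar c_n=S_n^2S_{n+1}T_{n+3}T_{n+4}^2$.
   Context: $(S_n)_{n\in\mathbb{Z}}$ is the sequence with $S_{ -2}=S_{ -1}=S_0=S_1=S_2=1$ satisfying $S_{n+5}S_n=S_{n+4}S_{n+1}+S_{n+3}S_{n+2}$ for all $n\in\mathbb{Z}$ (positive integers, $S_{ -n}=S_n$). $(T_n)_{n\in\mathbb{Z}}$ is defined by $T_1=1,T_2=-1,T_3=1,T_4=1,T_5=-7$, $T_{n+5}T_n=T_{n+4}T_{n+1}+T_{n+3}T_{n+2}$ for $n\geq1$, $T_0=0$ and $T_{ -n}=-T_n$ (integers). -}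

module Defs where

open import Data.Integer using (ℤ; +_; -_; _+_; _*_; 0ℤ; 1ℤ; _>_)
open import Relation.Binary.PropositionalEquality using (_≡_)
open import Data.Product using (_×_)

record IsS (S : ℤ → ℤ) : Set where
  field
    S-₂ : S (- + 2) ≡ 1ℤ
    S-₁ : S (- + 1) ≡ 1ℤ
    S₀  : S (+ 0) ≡ 1ℤ
    S₁  : S (+ 1) ≡ 1ℤ
    S₂  : S (+ 2) ≡ 1ℤ
    S-rec : ∀ (n : ℤ) →
      S (n + + 5) * S n ≡ S (n + + 4) * S (n + + 1) + S (n + + 3) * S (n + + 2)

record IsT (T : ℤ → ℤ) : Set where
  field
    T₁ : T (+ 1) ≡ 1ℤ
    T₂ : T (+ 2) ≡ - 1ℤ
    T₃ : T (+ 3) ≡ 1ℤ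
    T₄ : T (+ 4) ≡ 1ℤ
    T₅ : T (+ 5) ≡ - (+ 7)
    T-rec : ∀ (n : ℤ) → n > 0ℤ →
      T (n + + 5) * T n ≡ T (n + + 4) * T (n + + 1) + T (n + + 3) * T (n + + 2)
    T₀ : T 0ℤ ≡ 0ℤ
    T-odd : ∀ (n : ℤ) → T (- n) ≡ - T n

aBar : (ℤ → ℤ) → (ℤ → ℤ) → ℤ → ℤ
aBar S T n = - (S (n + + 2) * T (n + + 1) * (T (n + + 2) * T (n + + 2) * T (n + + 2)) * T (n + + 3))

bBar : (ℤ → ℤ) → (ℤ → ℤ) → ℤ → ℤ
bBar S T n = S (n + + 1) * (S (n + + 2) * S (n + + 2) * S (n + + 2)) * S (n + + 3) * T (n + + 2)

cBar : (ℤ → ℤ) → (ℤ → ℤ) → ℤ → ℤ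
cBar S T n = (S n * S n) * S (n + + 1) * T (n + + 3) * (T (n + + 4) * T (n + + 4))

-- Both S and T satisfy the Somos-5 recurrence on all of ℤ (for T this follows from oddness).
-- In such a sequence a common divisor of two terms at distance 1 or 2 divides a product of
-- two other such terms, so pairwise coprimality at distance ≤ 2 spreads in both directions
-- from a single window of four terms, and then reaches distance 3 and 4 too.
-- The two sequences are tied together by
--   T(j+3) T(j+2) = 2 S(j+2) S(j+3) − S(j) S(j+5),
-- proved for j ≥ 0 by induction together with T(j+3) T(j) = 2 S(j+1) S(j+2) − S(j) S(j+3),
-- using the Somos-7 type relation S(j+7) S(j) + S(j+6) S(j+1) = 8 S(j+4) S(j+3) and the fact
-- that the right-hand side never vanishes, and carried to j < 0 by S(−j) = S(j), T(−j) = −T(j).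
-- Through this identity S(i) and T(j) are coprime whenever |i − j| ≤ 2. Consequently each
-- factor of ā_n is coprime to b̄_n or to c̄_n, so a common divisor of ā_n, b̄_n, c̄_n is a unit.
module Submission where

open import Defs
open import Data.Nat as ℕ using (ℕ; zero; suc; z≤n; s≤s)
import Data.Nat.Properties as ℕ
import Data.Nat.Divisibility as ℕ
import Data.Nat.Coprimality as ℕ
open import Data.Integer
  using (ℤ; +_; -[1+_]; +[1+_]; -_; _+_; _*_; _-_; 0ℤ; 1ℤ; _<_; _≤_; ∣_∣; +<+; +≤+)
open import Data.Integer.Base using (NonZero; >-nonZero; ≢-nonZero; positive; nonNegative)
open import Data.Integer.Properties
  using (+-assoc; +-comm; *-comm; +-identityʳ; +-inverseʳ; *-zeroʳ; abs-*; ∣-i∣≡∣i∣; i-j≡0⇒i≡j;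
         *-cancelʳ-≡; *-cancelˡ-≡; *-cancelʳ-≤-pos; *-monoˡ-≤-nonNeg; i≤i+j;
         ≤-reflexive; ≤-trans; <⇒≤; <-≤-trans; module ≤-Reasoning)
open import Data.Integer.Coprimality using (Coprime; coprime-divisor)
open import Data.Integer.Divisibility.Signed
  using (_∣_; ∣ᵤ⇒∣; ∣⇒∣ᵤ; ∣-refl; ∣m⇒∣m*n; ∣n⇒∣m*n; ∣m+n∣m⇒∣n)
open import Data.Integer.GCD using (gcd; gcd[i,j]∣i; gcd[i,j]∣j)
open import Data.Integer.Tactic.RingSolver using (solve-∀)
open import Data.Product using (_×_; _,_; proj₁; proj₂)
open import Function using (_∘_)
open import Relation.Nullary using (¬_)
open import Relation.Binary.PropositionalEquality

-- `Coprime x y` unfolds to a statement about ∣ x ∣ and ∣ y ∣ only, so x and y cannot be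
-- inferred from it; the record makes them visible to unification.
record IsCoprime (x y : ℤ) : Set where
  constructor isCoprime
  field coprime : Coprime x y

open IsCoprime

private
  variable
    a b x y z : ℤ

isCoprime-sym : IsCoprime x y → IsCoprime y x
isCoprime-sym (isCoprime c) = isCoprime (ℕ.sym c)

isCoprime-negʳ : IsCoprime x y → IsCoprime x (- y)
isCoprime-negʳ {y = y} (isCoprime c) =
  isCoprime λ (i∣x , i∣-y) → c (i∣x , subst (_ ℕ.∣_) (∣-i∣≡∣i∣ y) i∣-y)

isCoprime-*ʳ : IsCoprime x y → IsCoprime x z → IsCoprime x (y * z)
isCoprime-*ʳ {x} {y} {z} (isCoprime cxy) (isCoprime cxz) =
  isCoprime λ (i∣x , i∣yz) → cxz (i∣x , i∣z i∣x i∣yz)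
  where
  i∣z : ∀ {i} → i ℕ.∣ ∣ x ∣ → i ℕ.∣ ∣ y * z ∣ → i ℕ.∣ ∣ z ∣
  i∣z i∣x i∣yz = ℕ.coprime-divisor (λ (j∣i , j∣y) → cxy (ℕ.∣-trans j∣i i∣x , j∣y))
                                  (subst (_ ℕ.∣_) (abs-* y z) i∣yz)

isCoprime-square : IsCoprime x y → IsCoprime x (y * y)
isCoprime-square c = isCoprime-*ʳ c c

isCoprime-cube : IsCoprime x y → IsCoprime x (y * y * y)
isCoprime-cube c = isCoprime-*ʳ (isCoprime-square c) c

∣x∣≡1⇒isCoprime : ∣ x ∣ ≡ 1 → IsCoprime x y
∣x∣≡1⇒isCoprime {y = y} eq =
  isCoprime (subst (λ m → ℕ.Coprime m ∣ y ∣) (sym eq) (ℕ.1-coprimeTo ∣ y ∣))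

-- A common divisor of x and y divides z = y b − x a.
isCoprime-combination : y * b ≡ x * a + z → IsCoprime x z → IsCoprime x y
isCoprime-combination {y} {b} {x} {a} {z} eq (isCoprime cxz) =
  isCoprime λ {i} (i∣x , i∣y) → cxz (i∣x , ∣⇒∣ᵤ (i∣z (∣ᵤ⇒∣ {+ i} i∣x) (∣ᵤ⇒∣ {+ i} i∣y)))
  where
  i∣z : ∀ {i} → i ∣ x → i ∣ y → i ∣ z
  i∣z i∣x i∣y = ∣m+n∣m⇒∣n (subst (_ ∣_) eq (∣m⇒∣m*n b i∣y)) (∣m⇒∣m*n a i∣x)

isCoprime-divisorʳ : IsCoprime x y → ∣ z ∣ ℕ.∣ ∣ y ∣ → IsCoprime z x
isCoprime-divisorʳ (isCoprime c) z∣y = isCoprime λ (i∣z , i∣x) → c (i∣x , ℕ.∣-trans i∣z z∣y)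

isCoprime∧∣⇒∣x∣≡1 : IsCoprime x y → ∣ x ∣ ℕ.∣ ∣ y ∣ → ∣ x ∣ ≡ 1
isCoprime∧∣⇒∣x∣≡1 (isCoprime c) x∣y = c (ℕ.∣-refl , x∣y)

gcd≡1 : ∀ a b c → (∀ {g} → ∣ g ∣ ℕ.∣ ∣ b ∣ → ∣ g ∣ ℕ.∣ ∣ c ∣ → IsCoprime g a) → gcd (gcd a b) c ≡ 1ℤ
gcd≡1 a b c common = cong +_ (isCoprime∧∣⇒∣x∣≡1 (common {gcd (gcd a b) c} g∣b g∣c) g∣a)
  where
  g∣ab = gcd[i,j]∣i (gcd a b) c
  g∣a  = ℕ.∣-trans g∣ab (gcd[i,j]∣i a b)
  g∣b  = ℕ.∣-trans g∣ab (gcd[i,j]∣j a b)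
  g∣c  = gcd[i,j]∣j (gcd a b) c

vanishes : ∀ c {l r} → l ≡ r → c * (l - r) ≡ 0ℤ
vanishes c {l} {r} eq =
  trans (cong (λ u → c * (u - r)) eq) (trans (cong (c *_) (+-inverseʳ r)) (*-zeroʳ c))

-- Polynomial consequences of hypotheses lᵢ ≡ rᵢ are proved by exhibiting lhs − rhs as an
-- explicit combination Σ cᵢ (lᵢ − rᵢ), which the ring solver checks.
by-certificate : ∀ {lhs rhs ε} → lhs ≡ rhs + ε → ε ≡ 0ℤ → lhs ≡ rhs
by-certificate {rhs = rhs} identity ε≡0 =
  trans identity (trans (cong (_+_ rhs) ε≡0) (+-identityʳ rhs))

cong-*+* : ∀ {a b c d a′ b′ c′ d′} → a ≡ a′ → b ≡ b′ → c ≡ c′ → d ≡ d′ →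
           a * b + c * d ≡ a′ * b′ + c′ * d′
cong-*+* p q r s = cong₂ _+_ (cong₂ _*_ p q) (cong₂ _*_ r s)

cong-2**-* : ∀ {a b c d a′ b′ c′ d′} → a ≡ a′ → b ≡ b′ → c ≡ c′ → d ≡ d′ →
             + 2 * (a * b) - c * d ≡ + 2 * (a′ * b′) - c′ * d′
cong-2**-* p q r s = cong₂ _-_ (cong (+ 2 *_) (cong₂ _*_ p q)) (cong₂ _*_ r s)

*-cancel-known : ∀ {x y v c} .{{_ : NonZero c}} → y ≡ c → x * y ≡ v * c → x ≡ v
*-cancel-known {x} {v = v} {c} refl eq = *-cancelʳ-≡ x v c eq

*-pos : 0ℤ < a → 0ℤ < b → 0ℤ < a * b
*-pos {+[1+ m ]} {+[1+ n ]} _        _        = +<+ (s≤s z≤n)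
*-pos {+ _}      {+ 0}      _        (+<+ ())
*-pos {+ 0}      {+[1+ _ ]} (+<+ ()) _

+1-shift : ∀ n k → n + 1ℤ + + k ≡ n + + suc k
+1-shift n k = +-assoc n 1ℤ (+ k)

pred+1 : ∀ n → n - 1ℤ + + 1 ≡ n
pred+1 = solve-∀

pred+suc : ∀ n k → n - 1ℤ + + suc k ≡ n + + k
pred+suc n k = trans (sym (+-assoc (n - 1ℤ) (+ 1) (+ k))) (cong (_+ + k) (pred+1 n))

ℤ-induction : (P : ℤ → Set) → P 0ℤ → (∀ n → P n → P (n + 1ℤ)) → (∀ n → P (n + 1ℤ) → P n) →
              ∀ n → P n
ℤ-induction P p₀ up down = λ where
    (+ k)    → upward k
    -[1+ k ] → downward k
  where
  upward : ∀ k → P (+ k)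
  upward zero    = p₀
  upward (suc k) = subst (P ∘ +_) (ℕ.+-comm k 1) (up (+ k) (upward k))
  downward : ∀ k → P -[1+ k ]
  downward zero    = down -[1+ 0 ] p₀
  downward (suc k) = down -[1+ suc k ] (downward k)

record Somos5 (x₀ x₁ x₂ x₃ x₄ x₅ : ℤ) : Set where
  constructor somos5
  field recurrence : x₅ * x₀ ≡ x₄ * x₁ + x₃ * x₂

open Somos5

somos5-cong : ∀ {x₀ x₁ x₂ x₃ x₄ x₅ y₀ y₁ y₂ y₃ y₄ y₅} →
              x₀ ≡ y₀ → x₁ ≡ y₁ → x₂ ≡ y₂ → x₃ ≡ y₃ → x₄ ≡ y₄ → x₅ ≡ y₅ →
              Somos5 x₀ x₁ x₂ x₃ x₄ x₅ → Somos5 y₀ y₁ y₂ y₃ y₄ y₅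
somos5-cong refl refl refl refl refl refl r = r

somos5-reverse : ∀ {x₀ x₁ x₂ x₃ x₄ x₅} → Somos5 x₀ x₁ x₂ x₃ x₄ x₅ → Somos5 x₅ x₄ x₃ x₂ x₁ x₀
somos5-reverse {x₀} {x₁} {x₂} {x₃} {x₄} {x₅} (somos5 rec) =
  somos5 (trans (*-comm x₀ x₅) (trans rec (cong₂ _+_ (*-comm x₄ x₁) (*-comm x₃ x₂))))

record Window (x₁ x₂ x₃ x₄ : ℤ) : Set where
  field
    coprime₁₂ : IsCoprime x₁ x₂
    coprime₁₃ : IsCoprime x₁ x₃
    coprime₂₃ : IsCoprime x₂ x₃
    coprime₂₄ : IsCoprime x₂ x₄
    coprime₃₄ : IsCoprime x₃ x₄

open Window

window-cong : ∀ {x₁ x₂ x₃ x₄ y₁ y₂ y₃ y₄} → x₁ ≡ y₁ → x₂ ≡ y₂ → x₃ ≡ y₃ → x₄ ≡ y₄ →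
              Window x₁ x₂ x₃ x₄ → Window y₁ y₂ y₃ y₄
window-cong refl refl refl refl w = w

window-reverse : ∀ {x₁ x₂ x₃ x₄} → Window x₁ x₂ x₃ x₄ → Window x₄ x₃ x₂ x₁
window-reverse w = record
  { coprime₁₂ = isCoprime-sym (coprime₃₄ w)
  ; coprime₁₃ = isCoprime-sym (coprime₂₄ w)
  ; coprime₂₃ = isCoprime-sym (coprime₂₃ w)
  ; coprime₂₄ = isCoprime-sym (coprime₁₃ w)
  ; coprime₃₄ = isCoprime-sym (coprime₁₂ w)
  }

coprime-to-next : ∀ {x₀ x₁ x₂ x₃ x₄ x₅} → Somos5 x₀ x₁ x₂ x₃ x₄ x₅ → Window x₁ x₂ x₃ x₄ →
                  IsCoprime x₁ x₅ × IsCoprime x₂ x₅ × IsCoprime x₃ x₅ × IsCoprime x₄ x₅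
coprime-to-next {x₀} {x₁} {x₂} {x₃} {x₄} {x₅} (somos5 rec) w =
    isCoprime-combination (trans rec (cong (_+ x₃ * x₂) (*-comm x₄ x₁)))
      (isCoprime-*ʳ (coprime₁₃ w) (coprime₁₂ w))
  , isCoprime-combination
      (trans rec (trans (+-comm (x₄ * x₁) (x₃ * x₂)) (cong (_+ x₄ * x₁) (*-comm x₃ x₂))))
      (isCoprime-*ʳ (coprime₂₄ w) (isCoprime-sym (coprime₁₂ w)))
  , isCoprime-combination (trans rec (+-comm (x₄ * x₁) (x₃ * x₂)))
      (isCoprime-*ʳ (coprime₃₄ w) (isCoprime-sym (coprime₁₃ w)))
  , isCoprime-combination rec
      (isCoprime-*ʳ (isCoprime-sym (coprime₃₄ w)) (isCoprime-sym (coprime₂₄ w)))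

coprime-to-previous : ∀ {x₀ x₁ x₂ x₃ x₄ x₅} → Somos5 x₀ x₁ x₂ x₃ x₄ x₅ → Window x₁ x₂ x₃ x₄ →
                      IsCoprime x₀ x₁ × IsCoprime x₀ x₂ × IsCoprime x₀ x₃ × IsCoprime x₀ x₄
coprime-to-previous rec w =
  let c₄ , c₃ , c₂ , c₁ = coprime-to-next (somos5-reverse rec) (window-reverse w)
  in isCoprime-sym c₁ , isCoprime-sym c₂ , isCoprime-sym c₃ , isCoprime-sym c₄

window-next : ∀ {x₀ x₁ x₂ x₃ x₄ x₅} → Somos5 x₀ x₁ x₂ x₃ x₄ x₅ →
              Window x₁ x₂ x₃ x₄ → Window x₂ x₃ x₄ x₅
window-next rec w =
  let _ , _ , c₃ , c₄ = coprime-to-next rec w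
  in record { coprime₁₂ = coprime₂₃ w ; coprime₁₃ = coprime₂₄ w ; coprime₂₃ = coprime₃₄ w
            ; coprime₂₄ = c₃ ; coprime₃₄ = c₄ }

window-previous : ∀ {x₀ x₁ x₂ x₃ x₄ x₅} → Somos5 x₀ x₁ x₂ x₃ x₄ x₅ →
                  Window x₁ x₂ x₃ x₄ → Window x₀ x₁ x₂ x₃
window-previous rec w =
  let c₁ , c₂ , _ , _ = coprime-to-previous rec w
  in record { coprime₁₂ = c₁ ; coprime₁₃ = c₂ ; coprime₂₃ = coprime₁₂ w
            ; coprime₂₄ = coprime₁₃ w ; coprime₃₄ = coprime₂₃ w }

record CoprimeST (s₁ s₂ s₃ s₄ t₂ t₃ : ℤ) : Set where
  field
    s₂t₂ : IsCoprime s₂ t₂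
    s₃t₂ : IsCoprime s₃ t₂
    s₄t₂ : IsCoprime s₄ t₂
    s₁t₃ : IsCoprime s₁ t₃
    s₂t₃ : IsCoprime s₂ t₃
    s₃t₃ : IsCoprime s₃ t₃

coprimeST-cong : ∀ {s₁ s₂ s₃ s₄ t₂ t₃ s₁′ s₂′ s₃′ s₄′ t₂′ t₃′} →
                 s₁ ≡ s₁′ → s₂ ≡ s₂′ → s₃ ≡ s₃′ → s₄ ≡ s₄′ → t₂ ≡ t₂′ → t₃ ≡ t₃′ →
                 CoprimeST s₁ s₂ s₃ s₄ t₂ t₃ → CoprimeST s₁′ s₂′ s₃′ s₄′ t₂′ t₃′
coprimeST-cong refl refl refl refl refl refl c = c

-- A common divisor of sᵢ and t₂ or t₃ divides s₀ s₅: read t₃ t₂ = 2 s₂ s₃ − s₀ s₅ for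
-- i = 2, 3, and its rewritten form t₃ t₂ = s₀ s₅ − 2 s₁ s₄ for i = 1, 4.
coprime-S-T : ∀ {s₀ s₁ s₂ s₃ s₄ s₅ t₂ t₃} → t₃ * t₂ ≡ + 2 * (s₂ * s₃) - s₀ * s₅ →
              Somos5 s₀ s₁ s₂ s₃ s₄ s₅ → Window s₁ s₂ s₃ s₄ → CoprimeST s₁ s₂ s₃ s₄ t₂ t₃
coprime-S-T {s₀} {s₁} {s₂} {s₃} {s₄} {s₅} {t₂} {t₃} rel rec w =
  let c₀₁ , c₀₂ , c₀₃ , c₀₄ = coprime-to-previous rec w
      c₁₅ , c₂₅ , c₃₅ , c₄₅ = coprime-to-next rec w
      s₁⊥s₀s₅ = isCoprime-*ʳ (isCoprime-sym c₀₁) c₁₅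
      s₂⊥s₀s₅ = isCoprime-negʳ (isCoprime-*ʳ (isCoprime-sym c₀₂) c₂₅)
      s₃⊥s₀s₅ = isCoprime-negʳ (isCoprime-*ʳ (isCoprime-sym c₀₃) c₃₅)
      s₄⊥s₀s₅ = isCoprime-*ʳ (isCoprime-sym c₀₄) c₄₅
  in record
    { s₂t₂ = isCoprime-combination (trans (*-comm t₂ t₃) via-s₂) s₂⊥s₀s₅
    ; s₃t₂ = isCoprime-combination (trans (*-comm t₂ t₃) via-s₃) s₃⊥s₀s₅
    ; s₄t₂ = isCoprime-combination (trans (*-comm t₂ t₃) via-s₄) s₄⊥s₀s₅
    ; s₁t₃ = isCoprime-combination via-s₁ s₁⊥s₀s₅
    ; s₂t₃ = isCoprime-combination via-s₂ s₂⊥s₀s₅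
    ; s₃t₃ = isCoprime-combination via-s₃ s₃⊥s₀s₅
    }
  where
  via-s₂ : t₃ * t₂ ≡ s₂ * (+ 2 * s₃) + - (s₀ * s₅)
  via-s₂ = trans rel (identity s₂ s₃ s₀ s₅)
    where
    identity : ∀ a b c d → + 2 * (a * b) - c * d ≡ a * (+ 2 * b) + - (c * d)
    identity = solve-∀
  via-s₃ : t₃ * t₂ ≡ s₃ * (+ 2 * s₂) + - (s₀ * s₅)
  via-s₃ = trans rel (identity s₂ s₃ s₀ s₅)
    where
    identity : ∀ a b c d → + 2 * (a * b) - c * d ≡ b * (+ 2 * a) + - (c * d)
    identity = solve-∀
  via-s₁ : t₃ * t₂ ≡ s₁ * - (+ 2 * s₄) + s₀ * s₅
  via-s₁ = trans rel (by-certificate (identity s₀ s₁ s₂ s₃ s₄ s₅) (vanishes (- + 2) (recurrence rec)))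
    where
    identity : ∀ s₀ s₁ s₂ s₃ s₄ s₅ → + 2 * (s₂ * s₃) - s₀ * s₅
      ≡ s₁ * - (+ 2 * s₄) + s₀ * s₅ + - + 2 * (s₅ * s₀ - (s₄ * s₁ + s₃ * s₂))
    identity = solve-∀
  via-s₄ : t₃ * t₂ ≡ s₄ * - (+ 2 * s₁) + s₀ * s₅
  via-s₄ = trans via-s₁ (cong (_+ s₀ * s₅) (identity s₁ s₄))
    where
    identity : ∀ a b → a * - (+ 2 * b) ≡ b * - (+ 2 * a)
    identity = solve-∀

SomosAt : (ℤ → ℤ) → ℤ → Set
SomosAt f n = Somos5 (f n) (f (n + + 1)) (f (n + + 2)) (f (n + + 3)) (f (n + + 4)) (f (n + + 5))

IsSomos5 : (ℤ → ℤ) → Set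
IsSomos5 f = ∀ n → SomosAt f n

somos-windows : ∀ {f} → IsSomos5 f → Window (f (+ 1)) (f (+ 2)) (f (+ 3)) (f (+ 4)) →
                ∀ n → Window (f (n + + 1)) (f (n + + 2)) (f (n + + 3)) (f (n + + 4))
somos-windows {f} somos w₀ = ℤ-induction WindowAt w₀ up down
  where
  WindowAt : ℤ → Set
  WindowAt n = Window (f (n + + 1)) (f (n + + 2)) (f (n + + 3)) (f (n + + 4))
  shift : ∀ n k → f (n + 1ℤ + + k) ≡ f (n + + suc k)
  shift n k = cong f (+1-shift n k)
  up : ∀ n → WindowAt n → WindowAt (n + 1ℤ)
  up n w = window-cong (sym (shift n 1)) (sym (shift n 2)) (sym (shift n 3)) (sym (shift n 4))
             (window-next (somos n) w)
  down : ∀ n → WindowAt (n + 1ℤ) → WindowAt n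
  down n w = window-cong refl (shift n 1) (shift n 2) (shift n 3) (window-previous (somos (n + 1ℤ)) w)

somos-reflect : ∀ {f} → (∀ i → f (- i) ≡ - f i) → ∀ m → SomosAt f m → SomosAt f (- m - + 5)
somos-reflect {f} odd m (somos5 rec) = somos5 (begin
  f (n + + 5) * f n                                      ≡⟨ cong₂ _*_ (cong f (i₅ m)) (cong f (i₀ m)) ⟩
  f (- m) * f (- (m + + 5))                              ≡⟨ odd-product m (m + + 5) ⟩
  f (m + + 5) * f m                                      ≡⟨ rec ⟩
  f (m + + 4) * f (m + + 1) + f (m + + 3) * f (m + + 2)  ≡⟨ cong₂ _+_ (odd-product (m + + 1) (m + + 4))
                                                                      (odd-product (m + + 2) (m + + 3)) ⟨
  f (- (m + + 1)) * f (- (m + + 4)) + f (- (m + + 2)) * f (- (m + + 3))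
    ≡⟨ cong-*+* (cong f (i₄ m)) (cong f (i₁ m)) (cong f (i₃ m)) (cong f (i₂ m)) ⟨
  f (n + + 4) * f (n + + 1) + f (n + + 3) * f (n + + 2)  ∎)
  where
  open ≡-Reasoning
  n = - m - + 5
  i₀ : ∀ m → - m - + 5 ≡ - (m + + 5)
  i₀ = solve-∀
  i₁ : ∀ m → - m - + 5 + + 1 ≡ - (m + + 4)
  i₁ = solve-∀
  i₂ : ∀ m → - m - + 5 + + 2 ≡ - (m + + 3)
  i₂ = solve-∀
  i₃ : ∀ m → - m - + 5 + + 3 ≡ - (m + + 2)
  i₃ = solve-∀
  i₄ : ∀ m → - m - + 5 + + 4 ≡ - (m + + 1)
  i₄ = solve-∀
  i₅ : ∀ m → - m - + 5 + + 5 ≡ - m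
  i₅ = solve-∀
  neg-swap : ∀ a b → (- a) * (- b) ≡ b * a
  neg-swap = solve-∀
  odd-product : ∀ i j → f (- i) * f (- j) ≡ f j * f i
  odd-product i j = trans (cong₂ _*_ (odd i) (odd j)) (neg-swap (f i) (f j))

SomosℕAt : (ℕ → ℤ) → ℕ → Set
SomosℕAt g k = Somos5 (g k) (g (1 ℕ.+ k)) (g (2 ℕ.+ k)) (g (3 ℕ.+ k)) (g (4 ℕ.+ k)) (g (5 ℕ.+ k))

somos-on-ℕ : ∀ {f} → IsSomos5 f → ∀ k → SomosℕAt (f ∘ +_) k
somos-on-ℕ {f} somos k = somos5-cong refl (c 1) (c 2) (c 3) (c 4) (c 5) (somos (+ k))
  where
  c : ∀ d → f (+ k + + d) ≡ f (+ (d ℕ.+ k))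
  c d = cong (f ∘ +_) (ℕ.+-comm k d)

≤-by-recurrence : ∀ {x₀ x₁ x₄ x₅ e} → 0ℤ < x₀ → x₀ ≤ x₁ → 0ℤ ≤ x₄ → 0ℤ ≤ e →
                  x₅ * x₀ ≡ x₄ * x₁ + e → x₄ ≤ x₅
≤-by-recurrence {x₀} {x₁} {x₄} {x₅} {e} 0<x₀ x₀≤x₁ 0≤x₄ 0≤e rec =
  *-cancelʳ-≤-pos x₄ x₅ x₀ {{positive 0<x₀}} (begin
    x₄ * x₀       ≤⟨ *-monoˡ-≤-nonNeg x₄ {{nonNegative 0≤x₄}} x₀≤x₁ ⟩
    x₄ * x₁       ≤⟨ i≤i+j (x₄ * x₁) e {{nonNegative 0≤e}} ⟩
    x₄ * x₁ + e   ≡⟨ rec ⟨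
    x₅ * x₀       ∎)
  where open ≤-Reasoning

Somos7At : ℤ → (ℕ → ℤ) → ℕ → Set
Somos7At α g k = g (7 ℕ.+ k) * g k + g (6 ℕ.+ k) * g (1 ℕ.+ k) ≡ α * (g (4 ℕ.+ k) * g (3 ℕ.+ k))

somos7-step : ∀ α x₀ x₁ x₂ x₃ x₄ x₅ x₆ x₇ x₈ →
  x₅ * x₀ ≡ x₄ * x₁ + x₃ * x₂ → x₈ * x₃ ≡ x₇ * x₄ + x₆ * x₅ → x₇ * x₀ + x₆ * x₁ ≡ α * (x₄ * x₃) →
  (x₈ * x₁ + x₇ * x₂) * (x₄ * x₃) ≡ α * (x₅ * x₄) * (x₄ * x₃)
somos7-step α x₀ x₁ x₂ x₃ x₄ x₅ x₆ x₇ x₈ r₀ r₃ q =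
  by-certificate (identity α x₀ x₁ x₂ x₃ x₄ x₅ x₆ x₇ x₈)
    (cong₂ _+_ (vanishes (- (x₄ * x₇)) r₀) (cong₂ _+_ (vanishes (x₁ * x₄) r₃) (vanishes (x₄ * x₅) q)))
  where
  identity : ∀ α x₀ x₁ x₂ x₃ x₄ x₅ x₆ x₇ x₈ →
    (x₈ * x₁ + x₇ * x₂) * (x₄ * x₃) ≡ α * (x₅ * x₄) * (x₄ * x₃)
      + (- (x₄ * x₇) * (x₅ * x₀ - (x₄ * x₁ + x₃ * x₂))
      + (x₁ * x₄ * (x₈ * x₃ - (x₇ * x₄ + x₆ * x₅))
      + x₄ * x₅ * ((x₇ * x₀ + x₆ * x₁) - α * (x₄ * x₃))))
  identity = solve-∀

U V : (ℕ → ℤ) → ℕ → ℤ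
U g k = + 2 * (g (2 ℕ.+ k) * g (3 ℕ.+ k)) - g k * g (5 ℕ.+ k)
V g k = + 2 * (g (1 ℕ.+ k) * g (2 ℕ.+ k)) - g k * g (3 ℕ.+ k)

module _ {g : ℕ → ℤ} (somos : ∀ k → SomosℕAt g k) where

  somos-nondecreasing : 0ℤ < g 0 → g 0 ≤ g 1 → g 1 ≤ g 2 → g 2 ≤ g 3 → g 3 ≤ g 4 →
                        ∀ k → 0ℤ < g k × g k ≤ g (suc k)
  somos-nondecreasing p₀ m₀ m₁ m₂ m₃ k = let p , m , _ = window k in p , m
    where
    Window≤ : ℕ → Set
    Window≤ k = 0ℤ < g k × g k ≤ g (1 ℕ.+ k) × g (1 ℕ.+ k) ≤ g (2 ℕ.+ k) ×
                g (2 ℕ.+ k) ≤ g (3 ℕ.+ k) × g (3 ℕ.+ k) ≤ g (4 ℕ.+ k)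
    window : ∀ k → Window≤ k
    window zero = p₀ , m₀ , m₁ , m₂ , m₃
    window (suc k) with window k
    ... | p₀ , m₀₁ , m₁₂ , m₂₃ , m₃₄ =
      p₁ , m₁₂ , m₂₃ , m₃₄ , ≤-by-recurrence p₀ m₀₁ (<⇒≤ p₄) (<⇒≤ (*-pos p₃ p₂)) (recurrence (somos k))
      where
      p₁ = <-≤-trans p₀ m₀₁
      p₂ = <-≤-trans p₁ m₁₂
      p₃ = <-≤-trans p₂ m₂₃
      p₄ = <-≤-trans p₃ m₃₄

  somos-unique : ∀ {h} → (∀ k → SomosℕAt h k) → (∀ k → 0ℤ < g k) →
                 g 0 ≡ h 0 → g 1 ≡ h 1 → g 2 ≡ h 2 → g 3 ≡ h 3 → g 4 ≡ h 4 → ∀ k → g k ≡ h k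
  somos-unique {h} somosʰ pos e₀ e₁ e₂ e₃ e₄ k = proj₁ (window k)
    where
    Window≡ : ℕ → Set
    Window≡ k = g k ≡ h k × g (1 ℕ.+ k) ≡ h (1 ℕ.+ k) × g (2 ℕ.+ k) ≡ h (2 ℕ.+ k) ×
                g (3 ℕ.+ k) ≡ h (3 ℕ.+ k) × g (4 ℕ.+ k) ≡ h (4 ℕ.+ k)
    window : ∀ k → Window≡ k
    window zero = e₀ , e₁ , e₂ , e₃ , e₄
    window (suc k) with window k
    ... | e₀ , e₁ , e₂ , e₃ , e₄ = e₁ , e₂ , e₃ , e₄ ,
      *-cancelʳ-≡ _ _ (g k) {{>-nonZero (pos k)}} (begin
        g (5 ℕ.+ k) * g k                                      ≡⟨ recurrence (somos k) ⟩
        g (4 ℕ.+ k) * g (1 ℕ.+ k) + g (3 ℕ.+ k) * g (2 ℕ.+ k)  ≡⟨ cong-*+* e₄ e₁ e₃ e₂ ⟩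
        h (4 ℕ.+ k) * h (1 ℕ.+ k) + h (3 ℕ.+ k) * h (2 ℕ.+ k)  ≡⟨ recurrence (somosʰ k) ⟨
        h (5 ℕ.+ k) * h k                                      ≡⟨ cong (h (5 ℕ.+ k) *_) e₀ ⟨
        h (5 ℕ.+ k) * g k                                      ∎)
      where open ≡-Reasoning

  somos7-invariant : ∀ α → (∀ k → 0ℤ < g k) → Somos7At α g 0 → ∀ k → Somos7At α g k
  somos7-invariant α pos q₀ zero    = q₀
  somos7-invariant α pos q₀ (suc k) =
    *-cancelʳ-≡ _ _ (g (4 ℕ.+ k) * g (3 ℕ.+ k)) {{>-nonZero (*-pos (pos (4 ℕ.+ k)) (pos (3 ℕ.+ k)))}}
      (somos7-step α (g k) (g (1 ℕ.+ k)) (g (2 ℕ.+ k)) (g (3 ℕ.+ k)) (g (4 ℕ.+ k)) (g (5 ℕ.+ k))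
                     (g (6 ℕ.+ k)) (g (7 ℕ.+ k)) (g (8 ℕ.+ k))
                     (recurrence (somos k)) (recurrence (somos (3 ℕ.+ k))) (somos7-invariant α pos q₀ k))

  module _ (invariant : ∀ k → Somos7At (+ 8) g k) where

    U-product : ∀ k → U g k * U g (4 ℕ.+ k) ≡ (V g (3 ℕ.+ k) + U g (2 ℕ.+ k)) * V g (3 ℕ.+ k)
    U-product k = by-certificate (identity x₀ x₁ x₂ x₃ x₄ x₅ x₆ x₇ x₈ x₉)
      (cong₂ _+_ (vanishes (- (x₆ * x₇) - x₅ * x₈ + + 2 * x₄ * x₉) (recurrence (somos k)))
      (cong₂ _+_ (vanishes (- (+ 15 * x₅ * x₆) - + 16 * x₄ * x₇ + + 16 * x₃ * x₈) (recurrence (somos (1 ℕ.+ k))))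
      (cong₂ _+_ (vanishes (+ 8 * x₄ * x₅ + x₃ * x₆ - x₂ * x₇ - x₁ * x₈) (recurrence (somos (2 ℕ.+ k))))
      (cong₂ _+_ (vanishes (+ 15 * x₂ * x₅ - + 15 * x₁ * x₆ + + 2 * x₀ * x₇) (recurrence (somos (3 ℕ.+ k))))
      (cong₂ _+_ (vanishes (+ 2 * x₁ * x₄ - x₀ * x₅) (recurrence (somos (4 ℕ.+ k))))
      (cong₂ _+_ (vanishes (+ 2 * x₄ * x₇ - + 2 * x₃ * x₈) (invariant k))
                 (vanishes (x₂ * x₇) (invariant (1 ℕ.+ k)))))))))
      where
      x₀ = g k ; x₁ = g (1 ℕ.+ k) ; x₂ = g (2 ℕ.+ k) ; x₃ = g (3 ℕ.+ k) ; x₄ = g (4 ℕ.+ k)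
      x₅ = g (5 ℕ.+ k) ; x₆ = g (6 ℕ.+ k) ; x₇ = g (7 ℕ.+ k) ; x₈ = g (8 ℕ.+ k) ; x₉ = g (9 ℕ.+ k)
      identity : ∀ x₀ x₁ x₂ x₃ x₄ x₅ x₆ x₇ x₈ x₉ →
        (+ 2 * (x₂ * x₃) - x₀ * x₅) * (+ 2 * (x₆ * x₇) - x₄ * x₉)
          ≡ ((+ 2 * (x₄ * x₅) - x₃ * x₆) + (+ 2 * (x₄ * x₅) - x₂ * x₇)) * (+ 2 * (x₄ * x₅) - x₃ * x₆)
          + ((- (x₆ * x₇) - x₅ * x₈ + + 2 * x₄ * x₉) * (x₅ * x₀ - (x₄ * x₁ + x₃ * x₂))
          + ((- (+ 15 * x₅ * x₆) - + 16 * x₄ * x₇ + + 16 * x₃ * x₈) * (x₆ * x₁ - (x₅ * x₂ + x₄ * x₃))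
          + ((+ 8 * x₄ * x₅ + x₃ * x₆ - x₂ * x₇ - x₁ * x₈) * (x₇ * x₂ - (x₆ * x₃ + x₅ * x₄))
          + ((+ 15 * x₂ * x₅ - + 15 * x₁ * x₆ + + 2 * x₀ * x₇) * (x₈ * x₃ - (x₇ * x₄ + x₆ * x₅))
          + ((+ 2 * x₁ * x₄ - x₀ * x₅) * (x₉ * x₄ - (x₈ * x₅ + x₇ * x₆))
          + ((+ 2 * x₄ * x₇ - + 2 * x₃ * x₈) * ((x₇ * x₀ + x₆ * x₁) - + 8 * (x₄ * x₃))
          + x₂ * x₇ * ((x₈ * x₁ + x₇ * x₂) - + 8 * (x₅ * x₄))))))))
      identity = solve-∀

    V-product : ∀ k → U g k * V g (4 ℕ.+ k) ≡ (V g (3 ℕ.+ k) + U g (2 ℕ.+ k)) * U g (1 ℕ.+ k)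
    V-product k = by-certificate (identity x₀ x₁ x₂ x₃ x₄ x₅ x₆ x₇)
      (cong₂ _+_ (vanishes (- (+ 2 * x₅ * x₆)) (recurrence (somos k)))
      (cong₂ _+_ (vanishes (+ 8 * x₄ * x₅ + + 6 * x₃ * x₆ - + 8 * x₂ * x₇) (recurrence (somos (1 ℕ.+ k))))
      (cong₂ _+_ (vanishes (- (+ 8 * x₂ * x₅) + + 6 * x₁ * x₆ - x₀ * x₇) (recurrence (somos (2 ℕ.+ k))))
                 (vanishes (- (x₃ * x₆) + x₂ * x₇) (invariant k)))))
      where
      x₀ = g k ; x₁ = g (1 ℕ.+ k) ; x₂ = g (2 ℕ.+ k) ; x₃ = g (3 ℕ.+ k)
      x₄ = g (4 ℕ.+ k) ; x₅ = g (5 ℕ.+ k) ; x₆ = g (6 ℕ.+ k) ; x₇ = g (7 ℕ.+ k)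
      identity : ∀ x₀ x₁ x₂ x₃ x₄ x₅ x₆ x₇ →
        (+ 2 * (x₂ * x₃) - x₀ * x₅) * (+ 2 * (x₅ * x₆) - x₄ * x₇)
          ≡ ((+ 2 * (x₄ * x₅) - x₃ * x₆) + (+ 2 * (x₄ * x₅) - x₂ * x₇)) * (+ 2 * (x₃ * x₄) - x₁ * x₆)
          + ((- (+ 2 * x₅ * x₆)) * (x₅ * x₀ - (x₄ * x₁ + x₃ * x₂))
          + ((+ 8 * x₄ * x₅ + + 6 * x₃ * x₆ - + 8 * x₂ * x₇) * (x₆ * x₁ - (x₅ * x₂ + x₄ * x₃))
          + ((- (+ 8 * x₂ * x₅) + + 6 * x₁ * x₆ - x₀ * x₇) * (x₇ * x₂ - (x₆ * x₃ + x₅ * x₄))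
          + (- (x₃ * x₆) + x₂ * x₇) * ((x₇ * x₀ + x₆ * x₁) - + 8 * (x₄ * x₃)))))
      identity = solve-∀

module Sequences {S T : ℤ → ℤ} (isS : IsS S) (isT : IsT T) where
  open IsS isS
  open IsT isT

  S₃ : S (+ 3) ≡ + 2
  S₃ = *-cancel-known S-₂ (trans (S-rec (- + 2)) (cong-*+* S₂ S-₁ S₁ S₀))
  S₄ : S (+ 4) ≡ + 3
  S₄ = *-cancel-known S-₁ (trans (S-rec (- + 1)) (cong-*+* S₃ S₀ S₂ S₁))
  S₅ : S (+ 5) ≡ + 5
  S₅ = *-cancel-known S₀ (trans (S-rec (+ 0)) (cong-*+* S₄ S₁ S₃ S₂))
  S₆ : S (+ 6) ≡ + 11
  S₆ = *-cancel-known S₁ (trans (S-rec (+ 1)) (cong-*+* S₅ S₂ S₄ S₃))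
  S₇ : S (+ 7) ≡ + 37
  S₇ = *-cancel-known S₂ (trans (S-rec (+ 2)) (cong-*+* S₆ S₃ S₅ S₄))
  S₈ : S (+ 8) ≡ + 83
  S₈ = *-cancel-known S₃ (trans (S-rec (+ 3)) (cong-*+* S₇ S₄ S₆ S₅))
  S-₃ : S (- + 3) ≡ + 2
  S-₃ = *-cancel-known S₂
          (trans (*-comm (S (- + 3)) (S (+ 2))) (trans (S-rec (- + 3)) (cong-*+* S₁ S-₂ S₀ S-₁)))
  S-₄ : S (- + 4) ≡ + 3
  S-₄ = *-cancel-known S₁
          (trans (*-comm (S (- + 4)) (S (+ 1))) (trans (S-rec (- + 4)) (cong-*+* S₀ S-₃ S-₁ S-₂)))

  T₆ : T (+ 6) ≡ + 8
  T₆ = *-cancel-known T₁ (trans (T-rec (+ 1) (+<+ (s≤s z≤n))) (cong-*+* T₅ T₂ T₄ T₃))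
  T-₁ : T (- + 1) ≡ - 1ℤ
  T-₁ = trans (T-odd (+ 1)) (cong -_ T₁)
  T-₂ : T (- + 2) ≡ 1ℤ
  T-₂ = trans (T-odd (+ 2)) (cong -_ T₂)

  S-somos : IsSomos5 S
  S-somos n = somos5 (S-rec n)

  T-somos : IsSomos5 T
  T-somos +[1+ k ] = somos5 (T-rec +[1+ k ] (+<+ (s≤s z≤n)))
  T-somos (+ 0)    = somos5 (trans (cong₂ _*_ T₅ T₀) (sym (cong-*+* T₄ T₁ T₃ T₂)))
  T-somos -[1+ 0 ] = somos5 (trans (cong₂ _*_ T₄ T-₁) (sym (cong-*+* T₃ T₀ T₂ T₁)))
  T-somos -[1+ 1 ] = somos5 (trans (cong₂ _*_ T₃ T-₂) (sym (cong-*+* T₂ T-₁ T₁ T₀)))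
  T-somos -[1+ 2 ] = somos-reflect T-odd (- + 2) (T-somos -[1+ 1 ])
  T-somos -[1+ 3 ] = somos-reflect T-odd (- + 1) (T-somos -[1+ 0 ])
  T-somos -[1+ 4 ] = somos-reflect T-odd (+ 0) (T-somos (+ 0))
  T-somos -[1+ suc (suc (suc (suc (suc k)))) ] =
    subst (λ j → SomosAt T -[1+ suc j ]) (ℕ.+-comm k 4)
          (somos-reflect T-odd +[1+ k ] (somos5 (T-rec +[1+ k ] (+<+ (s≤s z≤n)))))

  S-windows : ∀ n → Window (S (n + + 1)) (S (n + + 2)) (S (n + + 3)) (S (n + + 4))
  S-windows = somos-windows S-somos record
    { coprime₁₂ = ∣x∣≡1⇒isCoprime (cong ∣_∣ S₁) ; coprime₁₃ = ∣x∣≡1⇒isCoprime (cong ∣_∣ S₁)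
    ; coprime₂₃ = ∣x∣≡1⇒isCoprime (cong ∣_∣ S₂) ; coprime₂₄ = ∣x∣≡1⇒isCoprime (cong ∣_∣ S₂)
    ; coprime₃₄ = subst₂ IsCoprime (sym S₃) (sym S₄) (isCoprime (ℕ.gcd≡1⇒coprime refl)) }

  T-windows : ∀ n → Window (T (n + + 1)) (T (n + + 2)) (T (n + + 3)) (T (n + + 4))
  T-windows = somos-windows T-somos record
    { coprime₁₂ = ∣x∣≡1⇒isCoprime (cong ∣_∣ T₁) ; coprime₁₃ = ∣x∣≡1⇒isCoprime (cong ∣_∣ T₁)
    ; coprime₂₃ = ∣x∣≡1⇒isCoprime (cong ∣_∣ T₂) ; coprime₂₄ = ∣x∣≡1⇒isCoprime (cong ∣_∣ T₂)
    ; coprime₃₄ = ∣x∣≡1⇒isCoprime (cong ∣_∣ T₃) }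

  s t : ℕ → ℤ
  s = S ∘ +_
  t = T ∘ +_

  s-somos : ∀ k → SomosℕAt s k
  s-somos = somos-on-ℕ S-somos

  t-somos : ∀ k → SomosℕAt t k
  t-somos = somos-on-ℕ T-somos

  s-windows : ∀ k → Window (s (1 ℕ.+ k)) (s (2 ℕ.+ k)) (s (3 ℕ.+ k)) (s (4 ℕ.+ k))
  s-windows k = window-cong (c 1) (c 2) (c 3) (c 4) (S-windows (+ k))
    where
    c : ∀ d → S (+ k + + d) ≡ s (d ℕ.+ k)
    c d = cong s (ℕ.+-comm k d)

  s-nondecreasing : ∀ k → 0ℤ < s k × s k ≤ s (suc k)
  s-nondecreasing = somos-nondecreasing s-somos
    (subst (0ℤ <_) (sym S₀) (+<+ (s≤s z≤n)))
    (≤-reflexive (trans S₀ (sym S₁))) (≤-reflexive (trans S₁ (sym S₂)))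
    (subst₂ _≤_ (sym S₂) (sym S₃) (+≤+ (s≤s z≤n))) (subst₂ _≤_ (sym S₃) (sym S₄) (+≤+ (s≤s (s≤s z≤n))))

  s-positive : ∀ k → 0ℤ < s k
  s-positive k = proj₁ (s-nondecreasing k)

  s≥3 : ∀ k → + 3 ≤ s (4 ℕ.+ k)
  s≥3 zero    = ≤-reflexive (sym S₄)
  s≥3 (suc k) = ≤-trans (s≥3 k) (proj₂ (s-nondecreasing (4 ℕ.+ k)))

  s-somos7 : ∀ k → Somos7At (+ 8) s k
  s-somos7 = somos7-invariant s-somos (+ 8) s-positive
    (trans (cong-*+* S₇ S₀ S₆ S₁) (sym (cong (+ 8 *_) (cong₂ _*_ S₄ S₃))))

  -- A zero would give s(k+5) ∣ 2 s(k+2) s(k+3) with s(k+5) coprime to both factors, yet s(k+5) ≥ 3.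
  U-nonzero : ∀ k → U s k ≢ 0ℤ
  U-nonzero k U≡0 = 3≰2 (ℕ.≤-trans (≤-∣∣ (s≥3 (1 ℕ.+ k))) (ℕ.∣⇒≤ s₅∣2))
    where
    s₂ = s (2 ℕ.+ k)
    s₃ = s (3 ℕ.+ k)
    s₅ = s (5 ℕ.+ k)
    3≰2 : ¬ 3 ℕ.≤ 2
    3≰2 (s≤s (s≤s ()))
    ≤-∣∣ : ∀ {m x} → + m ≤ x → m ℕ.≤ ∣ x ∣
    ≤-∣∣ (+≤+ m≤n) = m≤n
    coprime-s₅ : IsCoprime s₅ (s₂ * s₃)
    coprime-s₅ = let _ , c₂ , c₃ , _ = coprime-to-next (s-somos k) (s-windows k)
                 in isCoprime-*ʳ (isCoprime-sym c₂) (isCoprime-sym c₃)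
    s₅∣2 : ∣ s₅ ∣ ℕ.∣ 2
    s₅∣2 = coprime-divisor s₅ (s₂ * s₃) (+ 2) (coprime coprime-s₅)
             (∣⇒∣ᵤ (subst (s₅ ∣_) (trans (sym (i-j≡0⇒i≡j _ _ U≡0)) (*-comm (+ 2) (s₂ * s₃)))
                                   (∣n⇒∣m*n (s k) ∣-refl)))

  t₃t₂≡U : ∀ k → t (3 ℕ.+ k) * t (2 ℕ.+ k) ≡ U s k
  t₃t₂≡U k = proj₁ (window k)
    where
    TU TV : ℕ → Set
    TU k = t (3 ℕ.+ k) * t (2 ℕ.+ k) ≡ U s k
    TV k = t (3 ℕ.+ k) * t k ≡ V s k
    Window× : ℕ → Set
    Window× k = TU k × TU (1 ℕ.+ k) × TU (2 ℕ.+ k) × TU (3 ℕ.+ k) × TV (3 ℕ.+ k)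
    rearrange : ∀ a b c d → (a * b) * (c * d) ≡ (c * b) * (d * a)
    rearrange = solve-∀
    window : ∀ k → Window× k
    window zero =
        trans (cong₂ _*_ T₃ T₂) (sym (cong-2**-* S₂ S₃ S₀ S₅))
      , trans (cong₂ _*_ T₄ T₃) (sym (cong-2**-* S₃ S₄ S₁ S₆))
      , trans (cong₂ _*_ T₅ T₄) (sym (cong-2**-* S₄ S₅ S₂ S₇))
      , trans (cong₂ _*_ T₆ T₅) (sym (cong-2**-* S₅ S₆ S₃ S₈))
      , trans (cong₂ _*_ T₆ T₃) (sym (cong-2**-* S₄ S₅ S₃ S₆))
    window (suc k) with window k
    ... | u₀ , u₁ , u₂ , u₃ , v₃ = u₁ , u₂ , u₃ , u₄ , v₄
      where
      open ≡-Reasoning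
      t₂ = t (2 ℕ.+ k) ; t₃ = t (3 ℕ.+ k) ; t₄ = t (4 ℕ.+ k) ; t₆ = t (6 ℕ.+ k) ; t₇ = t (7 ℕ.+ k)
      instance
        U≢0 : NonZero (U s k)
        U≢0 = ≢-nonZero (U-nonzero k)
      t₇t₂ : t₇ * t₂ ≡ V s (3 ℕ.+ k) + U s (2 ℕ.+ k)
      t₇t₂ = trans (recurrence (t-somos (2 ℕ.+ k))) (cong₂ _+_ v₃ u₂)
      u₄ : TU (4 ℕ.+ k)
      u₄ = *-cancelˡ-≡ (U s k) _ _ (begin
        U s k * (t₇ * t₆)                                 ≡⟨ cong (_* (t₇ * t₆)) u₀ ⟨
        (t₃ * t₂) * (t₇ * t₆)                             ≡⟨ rearrange t₃ t₂ t₇ t₆ ⟩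
        (t₇ * t₂) * (t₆ * t₃)                             ≡⟨ cong₂ _*_ t₇t₂ v₃ ⟩
        (V s (3 ℕ.+ k) + U s (2 ℕ.+ k)) * V s (3 ℕ.+ k)   ≡⟨ U-product s-somos s-somos7 k ⟨
        U s k * U s (4 ℕ.+ k)                             ∎)
      v₄ : TV (4 ℕ.+ k)
      v₄ = *-cancelˡ-≡ (U s k) _ _ (begin
        U s k * (t₇ * t₄)                                 ≡⟨ cong (_* (t₇ * t₄)) u₀ ⟨
        (t₃ * t₂) * (t₇ * t₄)                             ≡⟨ rearrange t₃ t₂ t₇ t₄ ⟩
        (t₇ * t₂) * (t₄ * t₃)                             ≡⟨ cong₂ _*_ t₇t₂ u₁ ⟩
        (V s (3 ℕ.+ k) + U s (2 ℕ.+ k)) * U s (1 ℕ.+ k)   ≡⟨ V-product s-somos s-somos7 k ⟨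
        U s k * V s (4 ℕ.+ k)                             ∎)

  neg[5+k]+5≡neg[k] : ∀ k → - + (5 ℕ.+ k) + + 5 ≡ - + k
  neg[5+k]+5≡neg[k] k = identity (+ k)
    where
    identity : ∀ K → - (+ 5 + K) + + 5 ≡ - K
    identity = solve-∀

  S-even : ∀ k → S (- + k) ≡ s k
  S-even k = sym (somos-unique s-somos reflected s-positive refl (trans S₁ (sym S-₁))
                    (trans S₂ (sym S-₂)) (trans S₃ (sym S-₃)) (trans S₄ (sym S-₄)) k)
    where
    reflected : ∀ k → SomosℕAt (S ∘ -_ ∘ +_) k
    reflected k = somos5-cong (cong S (neg[5+k]+5≡neg[k] k)) refl refl refl refl refl
                    (somos5-reverse (S-somos (- + (5 ℕ.+ k))))

  T-S-relation : ∀ j → T (j + + 3) * T (j + + 2) ≡ + 2 * (S (j + + 2) * S (j + + 3)) - S j * S (j + + 5)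
  T-S-relation (+ k) rewrite ℕ.+-comm k 3 | ℕ.+-comm k 2 | ℕ.+-comm k 5 = t₃t₂≡U k
  T-S-relation -[1+ 0 ] = trans (cong₂ _*_ T₂ T₁) (sym (cong-2**-* S₁ S₂ S-₁ S₄))
  T-S-relation -[1+ 1 ] = trans (cong₂ _*_ T₁ T₀) (sym (cong-2**-* S₀ S₁ S-₂ S₃))
  T-S-relation -[1+ 2 ] = trans (cong₂ _*_ T₀ T-₁) (sym (cong-2**-* S-₁ S₀ S-₃ S₂))
  T-S-relation -[1+ 3 ] = trans (cong₂ _*_ T-₁ T-₂) (sym (cong-2**-* S-₂ S-₁ S-₄ S₁))
  T-S-relation -[1+ suc (suc (suc (suc m))) ] = begin
    T (- + (2 ℕ.+ m)) * T (- + (3 ℕ.+ m))   ≡⟨ cong₂ _*_ (T-odd (+ (2 ℕ.+ m))) (T-odd (+ (3 ℕ.+ m))) ⟩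
    (- t (2 ℕ.+ m)) * (- t (3 ℕ.+ m))      ≡⟨ neg-swap (t (2 ℕ.+ m)) (t (3 ℕ.+ m)) ⟩
    t (3 ℕ.+ m) * t (2 ℕ.+ m)              ≡⟨ t₃t₂≡U m ⟩
    U s m                                   ≡⟨ reorder (s (2 ℕ.+ m)) (s (3 ℕ.+ m)) (s m) (s (5 ℕ.+ m)) ⟩
    + 2 * (s (3 ℕ.+ m) * s (2 ℕ.+ m)) - s (5 ℕ.+ m) * s m
      ≡⟨ cong-2**-* (S-even (3 ℕ.+ m)) (S-even (2 ℕ.+ m)) (S-even (5 ℕ.+ m)) S[j+5]≡s[m] ⟨
    + 2 * (S (- + (3 ℕ.+ m)) * S (- + (2 ℕ.+ m))) - S (- + (5 ℕ.+ m)) * S (- + (5 ℕ.+ m) + + 5) ∎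
    where
    open ≡-Reasoning
    neg-swap : ∀ a b → (- a) * (- b) ≡ b * a
    neg-swap = solve-∀
    reorder : ∀ a b c d → + 2 * (a * b) - c * d ≡ + 2 * (b * a) - d * c
    reorder = solve-∀
    S[j+5]≡s[m] : S (- + (5 ℕ.+ m) + + 5) ≡ s m
    S[j+5]≡s[m] = trans (cong S (neg[5+k]+5≡neg[k] m)) (S-even m)

  S-T-coprime : ∀ j → CoprimeST (S (j + + 1)) (S (j + + 2)) (S (j + + 3)) (S (j + + 4))
                                (T (j + + 2)) (T (j + + 3))
  S-T-coprime j = coprime-S-T (T-S-relation j) (S-somos j) (S-windows j)

  S-T-coprime-pred : ∀ n → CoprimeST (S n) (S (n + + 1)) (S (n + + 2)) (S (n + + 3))
                                     (T (n + + 1)) (T (n + + 2))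
  S-T-coprime-pred n =
    coprimeST-cong (cong S (pred+1 n)) (cong S (pred+suc n 1)) (cong S (pred+suc n 2))
                   (cong S (pred+suc n 3)) (cong T (pred+suc n 1)) (cong T (pred+suc n 2))
                   (S-T-coprime (n - 1ℤ))

  S-T-coprime-suc : ∀ n → CoprimeST (S (n + + 2)) (S (n + + 3)) (S (n + + 4)) (S (n + + 5))
                                    (T (n + + 3)) (T (n + + 4))
  S-T-coprime-suc n =
    coprimeST-cong (cong S (+1-shift n 1)) (cong S (+1-shift n 2)) (cong S (+1-shift n 3))
                   (cong S (+1-shift n 4)) (cong T (+1-shift n 2)) (cong T (+1-shift n 3))
                   (S-T-coprime (n + 1ℤ))

  module _ (n : ℤ) where
    open CoprimeST

    private
      S-window = S-windows n
      T-window = T-windows n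
      around-pred = S-T-coprime-pred n
      around = S-T-coprime n
      around-suc = S-T-coprime-suc n

    S₂-coprime-c : IsCoprime (S (n + + 2)) (cBar S T n)
    S₂-coprime-c =
      isCoprime-*ʳ (isCoprime-*ʳ (isCoprime-*ʳ (isCoprime-square ⊥s₀) ⊥s₁) ⊥t₃) (isCoprime-square ⊥t₄)
      where
      ⊥s₀ = isCoprime-sym (proj₁ (proj₂ (coprime-to-previous (S-somos n) S-window)))
      ⊥s₁ = isCoprime-sym (coprime₁₂ S-window)
      ⊥t₃ = s₂t₃ around
      ⊥t₄ = s₁t₃ around-suc

    T₁-coprime-b : IsCoprime (T (n + + 1)) (bBar S T n)
    T₁-coprime-b = isCoprime-*ʳ (isCoprime-*ʳ (isCoprime-*ʳ ⊥s₁ (isCoprime-cube ⊥s₂)) ⊥s₃) ⊥t₂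
      where
      ⊥s₁ = isCoprime-sym (s₂t₂ around-pred)
      ⊥s₂ = isCoprime-sym (s₃t₂ around-pred)
      ⊥s₃ = isCoprime-sym (s₄t₂ around-pred)
      ⊥t₂ = coprime₁₂ T-window

    T₂-coprime-c : IsCoprime (T (n + + 2)) (cBar S T n)
    T₂-coprime-c =
      isCoprime-*ʳ (isCoprime-*ʳ (isCoprime-*ʳ (isCoprime-square ⊥s₀) ⊥s₁) ⊥t₃) (isCoprime-square ⊥t₄)
      where
      ⊥s₀ = isCoprime-sym (s₁t₃ around-pred)
      ⊥s₁ = isCoprime-sym (s₂t₃ around-pred)
      ⊥t₃ = coprime₂₃ T-window
      ⊥t₄ = coprime₂₄ T-window

    T₃-coprime-b : IsCoprime (T (n + + 3)) (bBar S T n)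
    T₃-coprime-b = isCoprime-*ʳ (isCoprime-*ʳ (isCoprime-*ʳ ⊥s₁ (isCoprime-cube ⊥s₂)) ⊥s₃) ⊥t₂
      where
      ⊥s₁ = isCoprime-sym (s₁t₃ around)
      ⊥s₂ = isCoprime-sym (s₂t₃ around)
      ⊥s₃ = isCoprime-sym (s₃t₃ around)
      ⊥t₂ = isCoprime-sym (coprime₂₃ T-window)

proposition3p11 : (S T : ℤ → ℤ) → IsS S → IsT T →
    ∀ (n : ℤ) → gcd (gcd (aBar S T n) (bBar S T n)) (cBar S T n) ≡ 1ℤ
proposition3p11 S T isS isT n = gcd≡1 (aBar S T n) (bBar S T n) (cBar S T n) λ g∣b g∣c →
  isCoprime-negʳ (isCoprime-*ʳ (isCoprime-*ʳ (isCoprime-*ʳ (isCoprime-divisorʳ (S₂-coprime-c n) g∣c)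
                                                          (isCoprime-divisorʳ (T₁-coprime-b n) g∣b))
                                            (isCoprime-cube (isCoprime-divisorʳ (T₂-coprime-c n) g∣c)))
                              (isCoprime-divisorʳ (T₃-coprime-b n) g∣b))
  where open Sequences isS isT
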